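{- For the path $P_n$ on $n\ge 2$ vertices, $C_{tr}(P_n)=2$ if $2\le n\le 7$, and $C_{tr}(P_n)=3$ if $n\ge 8$.
   Context: A set $S\subseteq V$ is a total restrained dominating set (TRD-set) of $G=(V,E)$ if every vertex of $V\setminus S$ is adjacent to at least one vertex of $S$ and to at least one other vertex of $V\setminus S$, and every vertex of $S$ is adjacent to at least one other vertex of $S$. Two disjoint sets $X,Y\subseteq V$ form a total restrained coalition if neither is a TRD-set but $X\cup Y$ is a TRD-set. A trc-partition of $G$ is a partition $\Phi$ of $V$ such that no member of $\Phi$ is a TRD-set and each member forms a total restrained coalition with some other member of $\Phi$. $C_{tr}(G)$ is the maximum cardinality of a trc-partition of $G$. -}

module Defs where

open import Data.Nat using (ℕ; suc; _+_; _≤_)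
open import Data.Fin using (Fin; toℕ)
open import Data.Product using (Σ; ∃; _×_)
open import Data.Sum using (_⊎_)
open import Relation.Nullary using (¬_)
open import Relation.Binary.PropositionalEquality using (_≡_; _≢_)

record Graph (n : ℕ) : Set₁ where
  field
    Adj     : Fin n → Fin n → Set
    symm    : ∀ {u v} → Adj u v → Adj v u
    irrefl  : ∀ {v} → ¬ Adj v v

open Graph public

VSet : ℕ → Set₁
VSet n = Fin n → Set

PathAdj : (n : ℕ) → Fin n → Fin n → Set
PathAdj n u v = (suc (toℕ u) ≡ toℕ v) ⊎ (suc (toℕ v) ≡ toℕ u)

pathAdj-symm : ∀ {n} {u v : Fin n} → PathAdj n u v → PathAdj n v u
pathAdj-symm (Data.Sum.inj₁ p) = Data.Sum.inj₂ p
pathAdj-symm (Data.Sum.inj₂ p) = Data.Sum.inj₁ p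

private
  n≢1+n : ∀ (m : ℕ) → ¬ (suc m ≡ m)
  n≢1+n ℕ.zero ()
  n≢1+n (suc m) p = n≢1+n m (Data.Nat.Properties.suc-injective p)
    where import Data.Nat.Properties

pathAdj-irrefl : ∀ {n} {v : Fin n} → ¬ PathAdj n v v
pathAdj-irrefl {v = v} (Data.Sum.inj₁ p) = n≢1+n (toℕ v) p
pathAdj-irrefl {v = v} (Data.Sum.inj₂ p) = n≢1+n (toℕ v) p

Path : (n : ℕ) → Graph n
Path n = record { Adj = PathAdj n ; symm = pathAdj-symm ; irrefl = pathAdj-irrefl }

IsTRD : ∀ {n} → Graph n → VSet n → Set
IsTRD {n} G S =
  (∀ (v : Fin n) → ¬ S v →
      (∃ λ u → Adj G v u × S u)
    × (∃ λ u → Adj G v u × ¬ S u × u ≢ v))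
  × (∀ (v : Fin n) → S v → ∃ λ u → Adj G v u × S u × u ≢ v)

-- A partition of V = Fin n into k (nonempty) members, encoded by a
-- surjective labelling f : Fin n → Fin k; member i is f⁻¹(i).
Member : ∀ {n k} → (Fin n → Fin k) → Fin k → VSet n
Member f i v = f v ≡ i

IsPartition : ∀ {n k} → (Fin n → Fin k) → Set
IsPartition {n} {k} f = ∀ (i : Fin k) → ∃ λ (v : Fin n) → f v ≡ i

TRCoalition : ∀ {n} → Graph n → VSet n → VSet n → Set
TRCoalition {n} G X Y =
  (∀ v → X v → Y v → Data.Empty.⊥)
  × ¬ IsTRD G X × ¬ IsTRD G Y
  × IsTRD G (λ v → X v ⊎ Y v)
  where import Data.Empty

IsTRCPartition : ∀ {n} → Graph n → (k : ℕ) → (Fin n → Fin k) → Set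
IsTRCPartition G k f =
  IsPartition f
  × (∀ i → ¬ IsTRD G (Member f i))
  × (∀ i → ∃ λ j → j ≢ i × TRCoalition G (Member f i) (Member f j))

Ctr≡ : ∀ {n} → Graph n → ℕ → Set
Ctr≡ {n} G c =
  (∃ λ (f : Fin n → Fin c) → IsTRCPartition G c f)
  × (∀ (k : ℕ) (f : Fin n → Fin k) → IsTRCPartition G k f → k ≤ c)

-- A vertex lies in every TRD-set if it is a leaf (it cannot be dominated from outside) or the
-- support of a leaf (the leaf needs a neighbour inside); on a path these are the vertices
-- 0, 1, n−2 and n−1.  Hence in a trc-partition every class other than the class a of the
-- first vertex forms a TRD-set together with a.  With four or more classes, each vertex v sees,
-- for three distinct further classes b, a neighbour in b ∪ a; as v has at most two neighbours,
-- one of them lies in a, which makes a itself a TRD-set.  With three or more classes on at most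
-- seven vertices, every vertex outside such a union b ∪ a lies in {2, 3, 4} together with a
-- neighbour outside it, so vertex 3 lies outside b ∪ a for every class b ≠ a, in particular
-- for its own class.  The partitions {0} ∪ rest and {0,1,6,…}, {2,3}, {4,5} attain the bounds.
module Submission where

open import Defs
open import Data.Nat using (ℕ; _≤_; zero; suc; _<_; _+_; z≤n; s≤s; s≤s⁻¹; _<?_)
open import Data.Product using (_×_; ∃; _,_; proj₁; proj₂)
open import Data.Nat.Properties
  using (≤-trans; ≤-reflexive; ≤-antisym; <⇒≤; <⇒≱; ≮⇒≥; m≤m+n; m≤n⇒m<n∨m≡n; suc-injective;
         m≤n⇒∃[o]m+o≡n)
open import Data.Fin as Fin using (Fin; toℕ; fromℕ<; _≟_; #_)
open import Data.Fin.Properties using (toℕ-injective; toℕ<n; toℕ-fromℕ<; ¬∀⟶∃¬; injective⇒≤)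
open import Data.List using (List; []; _∷_; length; lookup)
open import Data.List.Membership.Propositional using (_∈_; _∉_)
open import Data.List.Relation.Unary.Any using (here; there; index; any?)
open import Data.List.Relation.Unary.Any.Properties using (lookup-index)
open import Data.Sum using (_⊎_; inj₁; inj₂; [_,_]; swap)
open import Data.Empty using (⊥-elim)
open import Function using (_∘_; case_of_)
open import Function.Definitions using (Injective)
open import Relation.Nullary using (¬_; yes; no)
open import Relation.Nullary.Decidable using (True; toWitness)
open import Relation.Unary using (Decidable; _∪_; _≐_)
open import Relation.Unary.Properties using (_∪?_)
open import Relation.Binary.PropositionalEquality using (_≡_; _≢_; refl; sym; trans; cong; subst)

NeighbourIn : ∀ {n} → Graph n → Fin n → VSet n → Set
NeighbourIn G v S = ∃ λ u → Adj G v u × S u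

-- Restricted to decidable S: the leaf argument only refutes x ∉ S, and the sets it is applied
-- to (unions of partition classes) are decidable.
Forced : ∀ {n} → Graph n → Fin n → Set₁
Forced {n} G x = ∀ (S : VSet n) → Decidable S → IsTRD G S → S x

MaxDegree≤2 : ∀ {n} → Graph n → Set
MaxDegree≤2 G = ∀ {v x y z} → Adj G v x → Adj G v y → Adj G v z → x ≡ y ⊎ x ≡ z ⊎ y ≡ z

module _ {n} {G : Graph n} where

  adj⇒≢ : ∀ {v u} → Adj G v u → u ≢ v
  adj⇒≢ v~u refl = irrefl G v~u

  IsTRD-resp-≐ : ∀ {S S′ : VSet n} → S ≐ S′ → IsTRD G S → IsTRD G S′
  IsTRD-resp-≐ (S⊆S′ , S′⊆S) (outside , inside) =
    (λ v v∉S′ → let ((u , v~u , u∈S) , (w , v~w , w∉S , w≢v)) = outside v (v∉S′ ∘ S⊆S′)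
                in (u , v~u , S⊆S′ u∈S) , (w , v~w , w∉S ∘ S′⊆S , w≢v)) ,
    (λ v v∈S′ → let (u , v~u , u∈S , u≢v) = inside v (S′⊆S v∈S′) in u , v~u , S⊆S′ u∈S , u≢v)

  IsTRD⇒totallyDominating : ∀ {S} → Decidable S → IsTRD G S → ∀ v → NeighbourIn G v S
  IsTRD⇒totallyDominating S? (outside , inside) v with S? v
  ... | yes v∈S = let (u , v~u , u∈S , _) = inside v v∈S in u , v~u , u∈S
  ... | no v∉S = proj₁ (outside v v∉S)

  full-isTRD : (∀ v → ∃ (Adj G v)) → ∀ {S} → (∀ v → S v) → IsTRD G S
  full-isTRD neighbour all =
    (λ v v∉S → ⊥-elim (v∉S (all v))) ,
    (λ v _ → let (u , v~u) = neighbour v in u , v~u , all u , adj⇒≢ v~u)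

  leaf-forced : ∀ {v} → (∀ {u w} → Adj G v u → Adj G v w → u ≡ w) → Forced G v
  leaf-forced {v} unique S S? (outside , _) with S? v
  ... | yes v∈S = v∈S
  ... | no v∉S =
    let ((u , v~u , u∈S) , (w , v~w , w∉S , _)) = outside v v∉S
    in ⊥-elim (w∉S (subst S (unique v~u v~w) u∈S))

  support-forced : ∀ {v u} → (∀ {w} → Adj G v w → w ≡ u) → Forced G v → Forced G u
  support-forced only-u v-forced S S? T =
    let (w , v~w , w∈S , _) = proj₂ T _ (v-forced S S? T) in subst S (only-u v~w) w∈S

  TRCoalition-sym : ∀ {X Y} → TRCoalition G X Y → TRCoalition G Y X
  TRCoalition-sym (disjoint , X-not , Y-not , X∪Y) =
    (λ v y x → disjoint v x y) , Y-not , X-not , IsTRD-resp-≐ (swap , swap) X∪Y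

length<⇒∃∉ : ∀ {k} (xs : List (Fin k)) → length xs < k → ∃ λ b → b ∉ xs
length<⇒∃∉ {k} xs |xs|<k =
  ¬∀⟶∃¬ k (_∈ xs) (λ b → any? (b ≟_) xs) λ covered → <⇒≱ |xs|<k (injective⇒≤ (index-injective covered))
  where
  index-injective : (covered : ∀ b → b ∈ xs) → Injective _≡_ _≡_ (λ b → index (covered b))
  index-injective covered {b} {b′} same-index =
    trans (lookup-index (covered b))
          (trans (cong (lookup xs) same-index) (sym (lookup-index (covered b′))))

Member? : ∀ {n k} (f : Fin n → Fin k) i → Decidable (Member f i)
Member? f i v = f v ≟ i

module _ {n k} {G : Graph n} {f : Fin n → Fin k} where

  star-isTRCPartition : (c : Fin k) {d : Fin k} → d ≢ c → IsPartition f →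
    (∀ i → ¬ IsTRD G (Member f i)) → (∀ i → i ≢ c → IsTRD G (Member f c ∪ Member f i)) →
    IsTRCPartition G k f
  star-isTRCPartition c {d} d≢c onto not-TRD joins-c = onto , not-TRD , coalition
    where
    with-c : ∀ i → i ≢ c → TRCoalition G (Member f c) (Member f i)
    with-c i i≢c = (λ { v refl refl → i≢c refl }) , not-TRD c , not-TRD i , joins-c i i≢c

    coalition : ∀ i → ∃ λ j → j ≢ i × TRCoalition G (Member f i) (Member f j)
    coalition i with i ≟ c
    ... | yes refl = d , d≢c , with-c d d≢c
    ... | no i≢c = c , i≢c ∘ sym , TRCoalition-sym {G = G} (with-c i i≢c)

  forced-partner : ∀ {x} → Forced G x → IsTRCPartition G k f →
    ∀ i → i ≢ f x → IsTRD G (Member f i ∪ Member f (f x))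
  forced-partner x-forced (_ , _ , coalition) i i≢fx with coalition i
  ... | (j , _ , (_ , _ , _ , i∪j)) with x-forced _ (Member? f i ∪? Member? f j) i∪j
  ...   | inj₁ fx≡i = ⊥-elim (i≢fx (sym fx≡i))
  ...   | inj₂ refl = i∪j

  module _ (Δ≤2 : MaxDegree≤2 G) where

    neighbour-in-class : ∀ {v a b₁ b₂ b₃} → b₁ ≢ b₂ → b₁ ≢ b₃ → b₂ ≢ b₃ →
      NeighbourIn G v (Member f b₁ ∪ Member f a) → NeighbourIn G v (Member f b₂ ∪ Member f a) →
      NeighbourIn G v (Member f b₃ ∪ Member f a) → NeighbourIn G v (Member f a)
    neighbour-in-class _ _ _ (u , v~u , inj₂ u∈a) _ _ = u , v~u , u∈a
    neighbour-in-class _ _ _ _ (u , v~u , inj₂ u∈a) _ = u , v~u , u∈a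
    neighbour-in-class _ _ _ _ _ (u , v~u , inj₂ u∈a) = u , v~u , u∈a
    neighbour-in-class b₁≢b₂ b₁≢b₃ b₂≢b₃
      (u₁ , v~u₁ , inj₁ refl) (u₂ , v~u₂ , inj₁ refl) (u₃ , v~u₃ , inj₁ refl)
      with Δ≤2 v~u₁ v~u₂ v~u₃
    ... | inj₁ refl = ⊥-elim (b₁≢b₂ refl)
    ... | inj₂ (inj₁ refl) = ⊥-elim (b₁≢b₃ refl)
    ... | inj₂ (inj₂ refl) = ⊥-elim (b₂≢b₃ refl)

    forced-class-isTRD : ∀ {x} → Forced G x → 3 < k → IsTRCPartition G k f →
      IsTRD G (Member f (f x))
    forced-class-isTRD {x} x-forced 3<k P = outside , inside
      where
      a = f x

      fresh : (xs : List (Fin k)) → length xs ≤ 3 → ∃ λ b → b ∉ xs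
      fresh xs |xs|≤3 = length<⇒∃∉ xs (≤-trans (s≤s |xs|≤3) 3<k)

      partner : ∀ b → b ≢ a → IsTRD G (Member f b ∪ Member f a)
      partner = forced-partner x-forced P

      sees : ∀ b → b ≢ a → ∀ v → NeighbourIn G v (Member f b ∪ Member f a)
      sees b b≢a = IsTRD⇒totallyDominating {G = G} (Member? f b ∪? Member? f a) (partner b b≢a)

      inside : ∀ v → f v ≡ a → ∃ λ u → Adj G v u × f u ≡ a × u ≢ v
      inside v _ =
        let (b₁ , b₁∉) = fresh (a ∷ []) (s≤s z≤n)
            (b₂ , b₂∉) = fresh (a ∷ b₁ ∷ []) (s≤s (s≤s z≤n))
            (b₃ , b₃∉) = fresh (a ∷ b₁ ∷ b₂ ∷ []) (s≤s (s≤s (s≤s z≤n)))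
            (u , v~u , u∈a) =
              neighbour-in-class (b₂∉ ∘ there ∘ here ∘ sym) (b₃∉ ∘ there ∘ here ∘ sym)
                (b₃∉ ∘ there ∘ there ∘ here ∘ sym)
                (sees b₁ (b₁∉ ∘ here) v) (sees b₂ (b₂∉ ∘ here) v) (sees b₃ (b₃∉ ∘ here) v)
        in u , v~u , u∈a , adj⇒≢ {G = G} v~u

      outside : ∀ v → f v ≢ a →
        NeighbourIn G v (Member f a) × ∃ λ u → Adj G v u × f u ≢ a × u ≢ v
      outside v fv≢a =
        let (b₁ , b₁∉) = fresh (a ∷ f v ∷ []) (s≤s (s≤s z≤n))
            (b₂ , b₂∉) = fresh (a ∷ f v ∷ b₁ ∷ []) (s≤s (s≤s (s≤s z≤n)))
            v∉b₁∪a = [ b₁∉ ∘ there ∘ here ∘ sym , fv≢a ]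
            (w , v~w , w∉b₁∪a , w≢v) = proj₂ (proj₁ (partner b₁ (b₁∉ ∘ here)) v v∉b₁∪a)
        in neighbour-in-class (b₂∉ ∘ there ∘ there ∘ here ∘ sym) (b₁∉ ∘ there ∘ here)
             (b₂∉ ∘ there ∘ here)
             (sees b₁ (b₁∉ ∘ here) v) (sees b₂ (b₂∉ ∘ here) v) (sees (f v) fv≢a v) ,
           (w , v~w , w∉b₁∪a ∘ inj₂ , w≢v)

    trc-partition-size≤3 : ∀ {x} → Forced G x → IsTRCPartition G k f → k ≤ 3
    trc-partition-size≤3 {x} x-forced P =
      ≮⇒≥ λ 3<k → proj₁ (proj₂ P) (f x) (forced-class-isTRD x-forced 3<k P)

<2⇒≡0⊎≡1 : ∀ {m} → m < 2 → m ≡ 0 ⊎ m ≡ 1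
<2⇒≡0⊎≡1 (s≤s z≤n) = inj₁ refl
<2⇒≡0⊎≡1 (s≤s (s≤s z≤n)) = inj₂ refl

<≤2+⇒≡1+⊎≡2+ : ∀ {m n} → m < n → n ≤ 2 + m → suc m ≡ n ⊎ 2 + m ≡ n
<≤2+⇒≡1+⊎≡2+ m<n n≤2+m with m≤n⇒m<n∨m≡n n≤2+m
... | inj₁ n<2+m = inj₁ (≤-antisym m<n (s≤s⁻¹ n<2+m))
... | inj₂ n≡2+m = inj₂ (sym n≡2+m)

interior-edge∋3 : ∀ {i j} → 2 ≤ i → 3 + j ≤ 7 → suc i ≡ j → i ≡ 3 ⊎ j ≡ 3
interior-edge∋3 {1} (s≤s ()) _ _
interior-edge∋3 {2} _ _ refl = inj₂ refl
interior-edge∋3 {3} _ _ _ = inj₁ refl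
interior-edge∋3 {suc (suc (suc (suc i)))} _ (s≤s (s≤s (s≤s (s≤s (s≤s (s≤s (s≤s ()))))))) refl

module _ {n : ℕ} where

  right-neighbour : ∀ {m} (v : Fin n) → toℕ v ≡ m → suc m < n →
    ∃ λ u → PathAdj n v u × toℕ u ≡ suc m
  right-neighbour v v≡m m+1<n =
    fromℕ< m+1<n , inj₁ (trans (cong suc v≡m) (sym (toℕ-fromℕ< m+1<n))) , toℕ-fromℕ< m+1<n

  left-neighbour : ∀ {m} (v : Fin n) → toℕ v ≡ suc m → ∃ λ u → PathAdj n v u × toℕ u ≡ m
  left-neighbour {m} v v≡m+1 =
    fromℕ< m<n , inj₂ (trans (cong suc (toℕ-fromℕ< m<n)) (sym v≡m+1)) , toℕ-fromℕ< m<n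
    where
    m<n : m < n
    m<n = ≤-trans (≤-reflexive (sym v≡m+1)) (<⇒≤ (toℕ<n v))

  path-maxDegree≤2 : MaxDegree≤2 (Path n)
  path-maxDegree≤2 (inj₁ p) (inj₁ q) _ = inj₁ (toℕ-injective (trans (sym p) q))
  path-maxDegree≤2 (inj₁ p) (inj₂ _) (inj₁ r) = inj₂ (inj₁ (toℕ-injective (trans (sym p) r)))
  path-maxDegree≤2 (inj₁ _) (inj₂ q) (inj₂ r) = inj₂ (inj₂ (toℕ-injective (suc-injective (trans q (sym r)))))
  path-maxDegree≤2 (inj₂ _) (inj₁ q) (inj₁ r) = inj₂ (inj₂ (toℕ-injective (trans (sym q) r)))
  path-maxDegree≤2 (inj₂ p) (inj₁ _) (inj₂ r) = inj₂ (inj₁ (toℕ-injective (suc-injective (trans p (sym r)))))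
  path-maxDegree≤2 (inj₂ p) (inj₂ q) _ = inj₁ (toℕ-injective (suc-injective (trans p (sym q))))

  first-leaf : ∀ {v u : Fin n} → toℕ v ≡ 0 → PathAdj n v u → toℕ u ≡ 1
  first-leaf v≡0 (inj₁ p) = trans (sym p) (cong suc v≡0)
  first-leaf v≡0 (inj₂ p) = case trans p v≡0 of λ ()

  last-leaf : ∀ {v u : Fin n} → suc (toℕ v) ≡ n → PathAdj n v u → suc (toℕ u) ≡ toℕ v
  last-leaf {u = u} v+1≡n (inj₁ p) = ⊥-elim (<⇒≱ (toℕ<n u) (≤-reflexive (trans (sym v+1≡n) p)))
  last-leaf v+1≡n (inj₂ p) = p

  first-forced : ∀ {v} → toℕ v ≡ 0 → Forced (Path n) v
  first-forced v≡0 = leaf-forced {G = Path n} λ v~u v~w →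
    toℕ-injective (trans (first-leaf v≡0 v~u) (sym (first-leaf v≡0 v~w)))

  second-forced : ∀ {v} → toℕ v ≡ 1 → Forced (Path n) v
  second-forced {v} v≡1 =
    let (first , _ , first≡0) = left-neighbour v v≡1
    in support-forced {G = Path n}
         (λ first~w → toℕ-injective (trans (first-leaf first≡0 first~w) (sym v≡1)))
         (first-forced first≡0)

  last-forced : ∀ {v} → suc (toℕ v) ≡ n → Forced (Path n) v
  last-forced v+1≡n = leaf-forced {G = Path n} λ v~u v~w →
    toℕ-injective (suc-injective (trans (last-leaf v+1≡n v~u) (sym (last-leaf v+1≡n v~w))))

  second-last-forced : ∀ {v} → 2 + toℕ v ≡ n → Forced (Path n) v
  second-last-forced {v} v+2≡n =
    let (last , _ , last≡v+1) = right-neighbour v refl (≤-reflexive v+2≡n)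
        last+1≡n = trans (cong suc last≡v+1) v+2≡n
    in support-forced {G = Path n}
         (λ last~w → toℕ-injective (suc-injective (trans (last-leaf last+1≡n last~w) last≡v+1)))
         (last-forced last+1≡n)

  path-forced : ∀ (v : Fin n) → toℕ v < 2 ⊎ n ≤ 2 + toℕ v → Forced (Path n) v
  path-forced v (inj₁ v<2) = [ first-forced , second-forced ] (<2⇒≡0⊎≡1 v<2)
  path-forced v (inj₂ n≤v+2) =
    [ last-forced , second-last-forced ] (<≤2+⇒≡1+⊎≡2+ (toℕ<n v) n≤v+2)

  outside-interior : ∀ {S : VSet n} → Decidable S → IsTRD (Path n) S →
    ∀ {v} → ¬ S v → 2 ≤ toℕ v × 3 + toℕ v ≤ n
  outside-interior S? T {v} v∉S =
    ≮⇒≥ (λ v<2 → v∉S (path-forced v (inj₁ v<2) _ S? T)) ,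
    ≮⇒≥ (λ n<v+3 → v∉S (path-forced v (inj₂ (s≤s⁻¹ n<v+3)) _ S? T))

  short-path-edge-meets-3 : n ≤ 7 → ∀ {S : VSet n} → Decidable S → IsTRD (Path n) S →
    ∀ {x y} → ¬ S x → ¬ S y → suc (toℕ x) ≡ toℕ y → ∃ λ w → toℕ w ≡ 3 × ¬ S w
  short-path-edge-meets-3 n≤7 S? T {x} {y} x∉S y∉S x+1≡y =
    [ (λ x≡3 → x , x≡3 , x∉S) , (λ y≡3 → y , y≡3 , y∉S) ]
      (interior-edge∋3 (proj₁ (outside-interior S? T x∉S))
                       (≤-trans (proj₂ (outside-interior S? T y∉S)) n≤7) x+1≡y)

  short-path-misses-3 : n ≤ 7 → ∀ {S : VSet n} → Decidable S → IsTRD (Path n) S →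
    ∀ {z} → ¬ S z → ∃ λ w → toℕ w ≡ 3 × ¬ S w
  short-path-misses-3 n≤7 S? T {z} z∉S with proj₂ (proj₁ T z z∉S)
  ... | (z′ , inj₁ z+1≡z′ , z′∉S , _) = short-path-edge-meets-3 n≤7 S? T z∉S z′∉S z+1≡z′
  ... | (z′ , inj₂ z′+1≡z , z′∉S , _) = short-path-edge-meets-3 n≤7 S? T z′∉S z∉S z′+1≡z

module _ {n k} (f : Fin (suc n) → Fin k) where

  path-trc-partition-size≤3 : IsTRCPartition (Path (suc n)) k f → k ≤ 3
  path-trc-partition-size≤3 =
    trc-partition-size≤3 {G = Path (suc n)} path-maxDegree≤2 (first-forced {v = Fin.zero} refl)

  short-path-trc-partition-size≤2 : suc n ≤ 7 → IsTRCPartition (Path (suc n)) k f → k ≤ 2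
  short-path-trc-partition-size≤2 1+n≤7 P = ≮⇒≥ λ 2<k →
    let (c₀ , c₀∉) = length<⇒∃∉ (a ∷ []) (≤-trans (s≤s (s≤s z≤n)) 2<k)
        (w , w≡3 , w∉c₀∪a) = vertex3-outside 2<k c₀ (c₀∉ ∘ here)
        (w′ , w′≡3 , w′∉fw∪a) = vertex3-outside 2<k (f w) (w∉c₀∪a ∘ inj₂)
    in w′∉fw∪a (inj₁ (cong f (toℕ-injective (trans w′≡3 (sym w≡3)))))
    where
    a = f Fin.zero

    vertex3-outside : 2 < k → ∀ c → c ≢ a → ∃ λ w → toℕ w ≡ 3 × ¬ (Member f c ∪ Member f a) w
    vertex3-outside 2<k c c≢a =
      let (b , b∉) = length<⇒∃∉ (a ∷ c ∷ []) 2<k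
          (z , fz≡b) = proj₁ P b
      in short-path-misses-3 1+n≤7 (Member? f c ∪? Member? f a)
           (forced-partner {G = Path (suc n)} (first-forced refl) P c c≢a)
           [ b∉ ∘ there ∘ here ∘ trans (sym fz≡b) , b∉ ∘ here ∘ trans (sym fz≡b) ]

path-neighbour : ∀ {m} (v : Fin (2 + m)) → ∃ (PathAdj (2 + m) v)
path-neighbour Fin.zero = # 1 , inj₁ refl
path-neighbour (Fin.suc w) = let (u , v~u , _) = left-neighbour (Fin.suc w) refl in u , v~u

-- The TRD conditions read off the vertex indices.  They are demanded for every m ∈ ℕ, not
-- only m < n, so that the tables below need no bound on m.
data IndexNeighbour (n : ℕ) (Q : ℕ → Set) : ℕ → Set where
  right : ∀ {m} → suc m < n → Q (suc m) → IndexNeighbour n Q m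
  left  : ∀ {m} → Q m → IndexNeighbour n Q (suc m)

data LocallyTRD (n : ℕ) (Q : ℕ → Set) (m : ℕ) : Set where
  inside  : Q m → IndexNeighbour n Q m → LocallyTRD n Q m
  outside : ¬ Q m → IndexNeighbour n Q m → IndexNeighbour n (¬_ ∘ Q) m → LocallyTRD n Q m

module _ {n : ℕ} where

  index-neighbour : ∀ {Q m} (v : Fin n) → toℕ v ≡ m → IndexNeighbour n Q m →
    NeighbourIn (Path n) v (Q ∘ toℕ)
  index-neighbour {Q} v v≡m (right m+1<n q) =
    let (u , v~u , u≡m+1) = right-neighbour v v≡m m+1<n in u , v~u , subst Q (sym u≡m+1) q
  index-neighbour {Q} v v≡m+1 (left q) =
    let (u , v~u , u≡m) = left-neighbour v v≡m+1 in u , v~u , subst Q (sym u≡m) q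

  path-isTRD : ∀ {Q} → (∀ m → LocallyTRD n Q m) → IsTRD (Path n) (Q ∘ toℕ)
  path-isTRD {Q} local = outside-ok , inside-ok
    where
    outside-ok : ∀ v → ¬ Q (toℕ v) →
      NeighbourIn (Path n) v (Q ∘ toℕ) × ∃ λ u → PathAdj n v u × ¬ Q (toℕ u) × u ≢ v
    outside-ok v v∉ with local (toℕ v)
    ... | inside v∈ _ = ⊥-elim (v∉ v∈)
    ... | outside _ near-in near-out =
      let (u , v~u , u∉) = index-neighbour v refl near-out
      in index-neighbour v refl near-in , u , v~u , u∉ , adj⇒≢ {G = Path n} v~u

    inside-ok : ∀ v → Q (toℕ v) → ∃ λ u → PathAdj n v u × Q (toℕ u) × u ≢ v
    inside-ok v v∈ with local (toℕ v)
    ... | outside v∉ _ _ = ⊥-elim (v∉ v∈)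
    ... | inside _ near-in =
      let (u , v~u , u∈) = index-neighbour v refl near-in in u , v~u , u∈ , adj⇒≢ {G = Path n} v~u

twoClasses : ∀ {n} → Fin n → Fin 2
twoClasses Fin.zero = # 1
twoClasses (Fin.suc _) = # 0

path-two-classes : ∀ m → IsTRCPartition (Path (2 + m)) 2 twoClasses
path-two-classes m = star-isTRCPartition {G = Path (2 + m)} (# 0) {# 1} (λ ()) onto not-TRD joins-0
  where
  onto : IsPartition twoClasses
  onto Fin.zero = # 1 , refl
  onto (Fin.suc Fin.zero) = # 0 , refl

  not-TRD : ∀ i → ¬ IsTRD (Path (2 + m)) (Member twoClasses i)
  not-TRD Fin.zero T = case first-forced {v = # 0} refl _ (Member? twoClasses _) T of λ ()
  not-TRD (Fin.suc Fin.zero) T = case second-forced {v = # 1} refl _ (Member? twoClasses _) T of λ ()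

  joins-0 : ∀ i → i ≢ # 0 → IsTRD (Path (2 + m)) (Member twoClasses (# 0) ∪ Member twoClasses i)
  joins-0 Fin.zero 0≢0 = ⊥-elim (0≢0 refl)
  joins-0 (Fin.suc Fin.zero) _ =
    full-isTRD {G = Path (2 + m)} path-neighbour λ { Fin.zero → inj₂ refl ; (Fin.suc _) → inj₁ refl }

threeClasses : ℕ → Fin 3
threeClasses 0 = # 0
threeClasses 1 = # 0
threeClasses 2 = # 1
threeClasses 3 = # 1
threeClasses 4 = # 2
threeClasses 5 = # 2
threeClasses (suc (suc (suc (suc (suc (suc _)))))) = # 0

<8+ : ∀ {m} i {i<8 : True (i <? 8)} → i < 8 + m
<8+ {m} _ {i<8} = ≤-trans (toWitness i<8) (m≤m+n 8 m)

module _ (m : ℕ) where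

  private
    f : Fin (8 + m) → Fin 3
    f = threeClasses ∘ toℕ

    ZeroOne ZeroTwo : ℕ → Set
    ZeroOne i = threeClasses i ≡ # 0 ⊎ threeClasses i ≡ # 1
    ZeroTwo i = threeClasses i ≡ # 0 ⊎ threeClasses i ≡ # 2

    zeroOne-local : ∀ i → LocallyTRD (8 + m) ZeroOne i
    zeroOne-local 0 = inside (inj₁ refl) (right (<8+ 1) (inj₁ refl))
    zeroOne-local 1 = inside (inj₁ refl) (left (inj₁ refl))
    zeroOne-local 2 = inside (inj₂ refl) (left (inj₁ refl))
    zeroOne-local 3 = inside (inj₂ refl) (left (inj₂ refl))
    zeroOne-local 4 = outside (λ { (inj₁ ()) ; (inj₂ ()) }) (left (inj₂ refl))
                              (right (<8+ 5) λ { (inj₁ ()) ; (inj₂ ()) })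
    zeroOne-local 5 = outside (λ { (inj₁ ()) ; (inj₂ ()) }) (right (<8+ 6) (inj₁ refl))
                              (left λ { (inj₁ ()) ; (inj₂ ()) })
    zeroOne-local 6 = inside (inj₁ refl) (right (<8+ 7) (inj₁ refl))
    zeroOne-local (suc (suc (suc (suc (suc (suc (suc _))))))) = inside (inj₁ refl) (left (inj₁ refl))

    zeroTwo-local : ∀ i → LocallyTRD (8 + m) ZeroTwo i
    zeroTwo-local 0 = inside (inj₁ refl) (right (<8+ 1) (inj₁ refl))
    zeroTwo-local 1 = inside (inj₁ refl) (left (inj₁ refl))
    zeroTwo-local 2 = outside (λ { (inj₁ ()) ; (inj₂ ()) }) (left (inj₁ refl))
                              (right (<8+ 3) λ { (inj₁ ()) ; (inj₂ ()) })
    zeroTwo-local 3 = outside (λ { (inj₁ ()) ; (inj₂ ()) }) (right (<8+ 4) (inj₂ refl))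
                              (left λ { (inj₁ ()) ; (inj₂ ()) })
    zeroTwo-local 4 = inside (inj₂ refl) (right (<8+ 5) (inj₂ refl))
    zeroTwo-local 5 = inside (inj₂ refl) (left (inj₂ refl))
    zeroTwo-local 6 = inside (inj₁ refl) (right (<8+ 7) (inj₁ refl))
    zeroTwo-local (suc (suc (suc (suc (suc (suc (suc _))))))) = inside (inj₁ refl) (left (inj₁ refl))

    vertex3-sees-no-0 : ∀ {u} → PathAdj (8 + m) (# 3) u → f u ≢ # 0
    vertex3-sees-no-0 (inj₁ 4≡u) rewrite sym 4≡u = λ ()
    vertex3-sees-no-0 (inj₂ u+1≡3) rewrite suc-injective u+1≡3 = λ ()

    onto : IsPartition f
    onto Fin.zero = # 0 , refl
    onto (Fin.suc Fin.zero) = # 2 , refl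
    onto (Fin.suc (Fin.suc Fin.zero)) = # 4 , refl

    not-TRD : ∀ i → ¬ IsTRD (Path (8 + m)) (Member f i)
    not-TRD Fin.zero (outside-ok , _) =
      let (u , 3~u , fu≡0) = proj₁ (outside-ok (# 3) λ ()) in vertex3-sees-no-0 3~u fu≡0
    not-TRD (Fin.suc i) T = case first-forced {v = # 0} refl _ (Member? f _) T of λ ()

    joins-0 : ∀ i → i ≢ # 0 → IsTRD (Path (8 + m)) (Member f (# 0) ∪ Member f i)
    joins-0 Fin.zero 0≢0 = ⊥-elim (0≢0 refl)
    joins-0 (Fin.suc Fin.zero) _ = path-isTRD zeroOne-local
    joins-0 (Fin.suc (Fin.suc Fin.zero)) _ = path-isTRD zeroTwo-local

  path-three-classes : IsTRCPartition (Path (8 + m)) 3 (threeClasses ∘ toℕ)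
  path-three-classes = star-isTRCPartition {G = Path (8 + m)} (# 0) {# 1} (λ ()) onto not-TRD joins-0

theorem3p8 : ∀ (n : ℕ) → 2 ≤ n →
    (n ≤ 7 → Ctr≡ (Path n) 2) × (8 ≤ n → Ctr≡ (Path n) 3)
theorem3p8 (suc (suc m)) (s≤s (s≤s z≤n)) =
  (λ n≤7 → (twoClasses , path-two-classes m) , λ _ f → short-path-trc-partition-size≤2 f n≤7) ,
  (λ 8≤n → let (o , 8+o≡n) = m≤n⇒∃[o]m+o≡n 8≤n
           in subst (λ n → Ctr≡ (Path n) 3) 8+o≡n
                ((_ , path-three-classes o) , λ _ f → path-trc-partition-size≤3 f))
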